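{- For every positive integer $i$, $$\Omega_\infty^{(i)}=\{\sigma\in\Omega_\infty:\ \sigma_N\in I_{\Omega_N}^i\cdot\mathbb{F}_2^{L_N}\ \text{for every } N\ge0\},$$ where $(\sigma_N)_{N\ge0}$ is the digital representation of $\sigma$.
   Context: $T_\infty$: Cayley graph of the free monoid on $\{x,y\}$ (word $w$ joined to $xw,yw$), $L_N$ = words of length $N$, $\Omega_\infty$ its profinite automorphism group, $\Omega_N$ the image of $\Omega_\infty$ in the automorphism group of the truncation $\bigcup_{i\le N}L_i$. For a word $w$, $\sigma_w$ is the involution fixing words not ending in $w$ and sending $v'w\mapsto\overline{v'}w$ ($x,y$ swapped in $v'$). Digital representation: every $\sigma\in\Omega_\infty$ is uniquely $\lim_N\sigma_N\cdots\sigma_0$ with $\sigma_N=\prod_{w\in L_N}\sigma_w^{\varepsilon_w}$; $\sigma_N$ is identified with the vector $(\varepsilon_w)_{w\in L_N}\in\mathbb{F}_2^{L_N}$, reflecting $\Omega_{N+1}=\mathbb{F}_2^{L_N}\rtimes\Omega_N$. $\mathbb{F}_2^{L_N}$ is an $\mathbb{F}_2[\Omega_N]$-module via the permutation action of $\Omega_N$ on $L_N$, and $I_{\Omega_N}$ is the augmentation ideal of $\mathbb{F}_2[\Omega_N]$. For a profinite group $G$, the descending central series is $G^{(0)}=G$ and $G^{(i+1)}=$ closure of $[G,G^{(i)}]$. -}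

module Defs where

open import Data.Bool using (Bool; true; false; not; if_then_else_; _xor_)
open import Data.Bool.Properties using () renaming (_≟_ to _≟ᴮ_)
open import Data.List using (List; []; _∷_; _++_; map; length; splitAt; concatMap; foldr)
open import Data.List.Properties using (≡-dec)
open import Data.Maybe using (Maybe; just; nothing)
open import Data.Nat using (ℕ; zero; suc; _∸_; _≤_)
open import Data.Product using (Σ; _×_; _,_)
open import Data.Unit using (⊤)
open import Function using (_∘_; id)
open import Relation.Binary.PropositionalEquality using (_≡_)
open import Relation.Nullary using (yes; no)

-- Letters: false = x, true = y.  Words are written as in the paper:
-- the children of w are  x w = false ∷ w  and  y w = true ∷ w,
-- so the head of the list is the letter farthest from the root.
Word : Set
Word = List Bool

L : ℕ → List Word
L zero    = [] ∷ []
L (suc n) = concatMap (λ w → (false ∷ w) ∷ (true ∷ w) ∷ []) (L n)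

_≟W_ : (u v : Word) → _
_≟W_ = ≡-dec _≟ᴮ_

stripSuffix : Word → Word → Maybe Word
stripSuffix w u with splitAt (length u ∸ length w) u
... | (v' , w'') with w'' ≟W w
...   | yes _ = just v'
...   | no  _ = nothing

sigma : Word → Word → Word
sigma w u with stripSuffix w u
... | just v' = map not v' ++ w
... | nothing = u

-- Digits: ε_w for every word w (a digital representation of an element of Ω_∞)
Digits : Set
Digits = Word → Bool

-- σ_N = ∏_{w ∈ L_N} σ_w^{ε_w}  (the factors commute)
level : Digits → ℕ → Word → Word
level ε N = foldr (λ w f → if ε w then sigma w ∘ f else f) id (L N)

levelsBelow : Digits → ℕ → Word → Word
levelsBelow ε zero    = id
levelsBelow ε (suc n) = level ε n ∘ levelsBelow ε n

-- The action of σ = lim σ_N ⋯ σ_0 on a word u: levels N ≥ |u| act trivially on u.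
act : Digits → Word → Word
act ε u = levelsBelow ε (length u) u

Map : Set
Map = Word → Word

InΩ : Map → Set
InΩ f = Σ Digits λ ε → ∀ u → f u ≡ act ε u

IsInverse : Map → Map → Set
IsInverse f g = (∀ u → f (g u) ≡ u) × (∀ u → g (f u) ≡ u)

data GenComm (P : Map → Set) : Map → Set where
  comm : ∀ g g' h h' → InΩ g → IsInverse g g' → P h → IsInverse h h' →
         GenComm P (g' ∘ h' ∘ g ∘ h)
  one  : GenComm P id
  mul  : ∀ {f g} → GenComm P f → GenComm P g → GenComm P (f ∘ g)
  inv  : ∀ {f g} → GenComm P f → IsInverse f g → GenComm P g
  ext  : ∀ {f g} → GenComm P f → (∀ u → f u ≡ g u) → GenComm P g

AgreeUpTo : ℕ → Map → Map → Set
AgreeUpTo N f g = ∀ u → length u ≤ N → f u ≡ g u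

-- Closure in Ω_∞ (profinite topology: basic neighbourhoods = kernels of Ω_∞ → Ω_N)
Closure : (Map → Set) → Map → Set
Closure H f = InΩ f × (∀ N → Σ Map λ h → H h × AgreeUpTo N h f)

LCS : ℕ → Map → Set
LCS zero    = InΩ
LCS (suc i) = Closure (GenComm (LCS i))

-- F_2^{L_N}: functions on words, only values on L_N matter
Vect : Set
Vect = Word → Bool

EqOn : ℕ → Vect → Vect → Set
EqOn N u v = ∀ w → length w ≡ N → u w ≡ v w

-- Prod N i v : v = (g_1 - 1)(g_2 - 1)⋯(g_i - 1) m  for some g_j ∈ Ω_N, m ∈ F_2^{L_N},
-- where g ∈ Ω_N acts on F_2^{L_N} by (g·u)(w) = u(g⁻¹ w);  g = act δ on L_N, g' its inverse there.
Prod : ℕ → ℕ → Vect → Set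
Prod N zero    v = ⊤
Prod N (suc i) v =
  Σ Digits λ δ → Σ Map λ g' → (∀ w → length w ≡ N → act δ (g' w) ≡ w) ×
  Σ Vect λ u → Prod N i u × EqOn N v (λ w → u (g' w) xor u w)

-- I_{Ω_N}^i · F_2^{L_N} : the F_2-span of the products above
data AugPow (N i : ℕ) : Vect → Set where
  zer : ∀ {v} → (∀ w → length w ≡ N → v w ≡ false) → AugPow N i v
  gen : ∀ {v} → Prod N i v → AugPow N i v
  add : ∀ {u v} → AugPow N i u → AugPow N i v → AugPow N i (λ w → u w xor v w)
  ext : ∀ {u v} → AugPow N i u → EqOn N u v → AugPow N i v

{-# OPTIONS --safe #-}
module Submission where

-- Written recursively (apply, with act ε = apply ε), the action of digits ε
-- composes and inverts by explicit formulas, so Ω_∞ becomes a group of digit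
-- functions. For f ∈ Ω_∞^{(j)}, v ↦ v ∘ f + v maps I^k F₂^{L_N} into
-- I^{k+j+1} F₂^{L_N}: this degree count survives products, inverses and
-- commutators. The digits of [g , h] are (γ ∘ h + γ) ∘ g + (η ∘ g⁻¹ + η) ∘ h ∘ g,
-- where γ, η are the digits of g, h; with the previous fact and induction on j
-- this puts the level-N digits of Ω_∞^{(j+1)} into I^{j+1}, level-N digits being
-- determined by the action on words of length ≤ N + 1.
-- Conversely σ is the limit of its truncations σ_{N-1} ⋯ σ_0, products of
-- single-level elements, and the single-level element with digits u ∘ g⁻¹ + u
-- is the commutator of (a truncation of) g⁻¹ with the one with digits u; when u ∈ I^j
-- the latter lies in Ω_∞^{(j)} by induction.

open import Defs
open import Data.Nat using (ℕ; _≤_)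
open import Function.Bundles using (_⇔_; mk⇔)

open import Data.Bool using (Bool; true; false; _xor_; _∧_; if_then_else_)
open import Data.Bool.Properties
  using (∧-identityʳ; ∧-zeroʳ; xor-same; xor-comm; xor-assoc; xor-identityʳ; xor-∧-commutativeRing)
open import Data.List using (List; []; _∷_; _++_; length; map; splitAt; take; drop; foldr; concatMap)
open import Data.List.Properties
  using (∷-injective; length-++; length-drop; take++drop≡id; map-id; map-∘; map-cong)
open import Data.List.Relation.Unary.All using (All; []; _∷_)
import Data.List.Relation.Unary.All as All
open import Data.List.Relation.Unary.All.Properties using (concat⁺; map⁺)
open import Data.Maybe using (Maybe; just; nothing)
open import Data.Nat using (zero; suc; _+_; _∸_; _<_; z≤n; s≤s; _<?_) renaming (_≟_ to _≟ℕ_)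
open import Data.Nat.Properties
  using (≤-refl; ≤-reflexive; ≤-trans; ≤-total; <⇒≤; <⇒≢; ≤⇒≯; <-≤-trans; <-cmp; n≤1+n; suc-injective;
         m≢1+n+m; m+n∸n≡m; m∸[m∸n]≡n; +-identityʳ; +-assoc; +-comm)
open import Data.Product using (Σ-syntax; _×_; _,_; proj₁; proj₂)
open import Data.Sum using (inj₁; inj₂)
open import Data.Unit using (tt)
open import Function using (_∘_; id)
open import Relation.Binary.Definitions using (tri<; tri≈; tri>)
open import Relation.Binary.PropositionalEquality
open import Relation.Nullary using (yes; no; ¬_; does)
open import Relation.Nullary.Decidable using (dec-true; dec-false)
open import Tactic.RingSolver using (solve-∀)
open import Tactic.RingSolver.Core.AlmostCommutativeRing using (AlmostCommutativeRing; fromCommutativeRing)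

open ≡-Reasoning

xor-ring : AlmostCommutativeRing _ _
xor-ring = fromCommutativeRing xor-∧-commutativeRing isFalse
  where
  isFalse : ∀ b → Maybe (false ≡ b)
  isFalse false = just refl
  isFalse true  = nothing

xor-cancelˡ : ∀ a b → a xor (a xor b) ≡ b
xor-cancelˡ = solve-∀ xor-ring

xor-cancelʳ : ∀ a b → (a xor b) xor b ≡ a
xor-cancelʳ = solve-∀ xor-ring

xor-swap : ∀ a b c → a xor (b xor c) ≡ (a xor c) xor b
xor-swap = solve-∀ xor-ring

xor-interchange : ∀ a b c d → (a xor b) xor (c xor d) ≡ (a xor c) xor (b xor d)
xor-interchange = solve-∀ xor-ring

xor-injectiveˡ : ∀ a {b c} → a xor b ≡ a xor c → b ≡ c
xor-injectiveˡ a {b} {c} e = trans (sym (xor-cancelˡ a b)) (trans (cong (a xor_) e) (xor-cancelˡ a c))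

-- The action of digit functions

-- parity ε u is the sum of the digits along the path from the root to
-- apply ε u, i.e. whether a letter placed above u gets swapped.
mutual
  apply : Digits → Word → Word
  apply ε []      = []
  apply ε (b ∷ u) = (b xor parity ε u) ∷ apply ε u

  parity : Digits → Word → Bool
  parity ε []      = ε []
  parity ε (a ∷ u) = parity ε u xor ε (apply ε (a ∷ u))

zeros : Digits
zeros _ = false

inverse : Digits → Digits
inverse ε w = ε (apply ε w)

infixl 7 _∙_
_∙_ : Digits → Digits → Digits
(ε ∙ δ) w = ε w xor δ (apply (inverse ε) w)

length-apply : ∀ ε u → length (apply ε u) ≡ length u
length-apply ε []      = refl
length-apply ε (b ∷ u) = cong suc (length-apply ε u)

parity-zeros : ∀ u → parity zeros u ≡ false
parity-zeros []      = refl
parity-zeros (a ∷ u) = cong (_xor false) (parity-zeros u)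

apply-zeros : ∀ u → apply zeros u ≡ u
apply-zeros []      = refl
apply-zeros (b ∷ u) = cong₂ _∷_ (trans (cong (b xor_) (parity-zeros u)) (xor-identityʳ b)) (apply-zeros u)

mutual
  apply-inverseˡ : ∀ ε u → apply (inverse ε) (apply ε u) ≡ u
  apply-inverseˡ ε []      = refl
  apply-inverseˡ ε (b ∷ u) =
    cong₂ _∷_ (trans (cong ((b xor parity ε u) xor_) (parity-inverseˡ ε u)) (xor-cancelʳ b (parity ε u)))
              (apply-inverseˡ ε u)

  parity-inverseˡ : ∀ ε u → parity (inverse ε) (apply ε u) ≡ parity ε u
  parity-inverseˡ ε []      = refl
  parity-inverseˡ ε (b ∷ u) =
    cong₂ _xor_ (parity-inverseˡ ε u) (cong (ε ∘ apply ε) (apply-inverseˡ ε (b ∷ u)))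

apply-inverseʳ : ∀ ε u → apply ε (apply (inverse ε) u) ≡ u
apply-inverseʳ ε []      = refl
apply-inverseʳ ε (b ∷ u) =
  cong₂ _∷_ (trans (cong ((b xor parity (inverse ε) u) xor_) parity-eq) (xor-cancelʳ b (parity (inverse ε) u)))
            (apply-inverseʳ ε u)
  where
  parity-eq : parity ε (apply (inverse ε) u) ≡ parity (inverse ε) u
  parity-eq = trans (sym (parity-inverseˡ ε (apply (inverse ε) u)))
                    (cong (parity (inverse ε)) (apply-inverseʳ ε u))

mutual
  apply-∙ : ∀ ε δ u → apply (ε ∙ δ) u ≡ apply ε (apply δ u)
  apply-∙ ε δ []      = refl
  apply-∙ ε δ (b ∷ u) =
    cong₂ _∷_ (trans (cong (b xor_) (parity-∙ ε δ u)) (xor-swap b (parity ε (apply δ u)) (parity δ u)))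
              (apply-∙ ε δ u)

  parity-∙ : ∀ ε δ u → parity (ε ∙ δ) u ≡ parity ε (apply δ u) xor parity δ u
  parity-∙ ε δ []      = refl
  parity-∙ ε δ (b ∷ u) =
    trans (cong₂ _xor_ (parity-∙ ε δ u) (digit-eq (apply-∙ ε δ (b ∷ u))))
          (xor-interchange (parity ε (apply δ u)) (parity δ u) _ _)
    where
    digit-eq : apply (ε ∙ δ) (b ∷ u) ≡ apply ε (apply δ (b ∷ u)) →
               (ε ∙ δ) (apply (ε ∙ δ) (b ∷ u)) ≡ ε (apply ε (apply δ (b ∷ u))) xor δ (apply δ (b ∷ u))
    digit-eq image = cong₂ _xor_ (cong ε image)
      (cong δ (trans (cong (apply (inverse ε)) image) (apply-inverseˡ ε (apply δ (b ∷ u)))))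

AgreeBelow : ℕ → Digits → Digits → Set
AgreeBelow n ε δ = ∀ w → length w < n → ε w ≡ δ w

VanishesBelow : ℕ → Digits → Set
VanishesBelow n ε = AgreeBelow n ε zeros

mutual
  apply-cong : ∀ {ε δ} u → AgreeBelow (length u) ε δ → apply ε u ≡ apply δ u
  apply-cong []      _     = refl
  apply-cong (b ∷ u) ε≈δ =
    cong₂ _∷_ (cong (b xor_) (parity-cong u ε≈δ)) (apply-cong u (λ w l → ε≈δ w (<-≤-trans l (n≤1+n _))))

  parity-cong : ∀ {ε δ} u → AgreeBelow (suc (length u)) ε δ → parity ε u ≡ parity δ u
  parity-cong         []      ε≈δ = ε≈δ [] (s≤s z≤n)
  parity-cong {ε} {δ} (a ∷ u) ε≈δ =
    cong₂ _xor_ (parity-cong u (λ w l → ε≈δ w (<-≤-trans l (n≤1+n _))))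
                (trans (cong ε (apply-cong (a ∷ u) (λ w l → ε≈δ w (<-≤-trans l (n≤1+n _)))))
                       (ε≈δ _ (s≤s (≤-reflexive (length-apply δ (a ∷ u))))))

apply-trivial : ∀ {n ε u} → VanishesBelow n ε → length u ≤ n → apply ε u ≡ u
apply-trivial {u = u} ε≈0 |u|≤n = trans (apply-cong u (λ w l → ε≈0 w (<-≤-trans l |u|≤n))) (apply-zeros u)

parity-trivial : ∀ {ε} u → VanishesBelow (suc (length u)) ε → parity ε u ≡ false
parity-trivial u ε≈0 = trans (parity-cong u ε≈0) (parity-zeros u)

inverse-vanishesBelow : ∀ {n ε} → VanishesBelow n ε → VanishesBelow n (inverse ε)
inverse-vanishesBelow {n} {ε} ε≈0 w l = ε≈0 (apply ε w) (subst (_< n) (sym (length-apply ε w)) l)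

∙-vanishingBelow : ∀ {n ε} → VanishesBelow n ε → ∀ δ w → length w ≤ n → (ε ∙ δ) w ≡ ε w xor δ w
∙-vanishingBelow {ε = ε} ε≈0 δ w l = cong (λ v → ε w xor δ v) (apply-trivial (inverse-vanishesBelow ε≈0) l)

inverse-involutive : ∀ ε w → inverse (inverse ε) w ≡ ε w
inverse-involutive ε w = cong ε (apply-inverseʳ ε w)

digits-unique : ∀ {ε δ} N → (∀ u → length u ≤ suc N → apply ε u ≡ apply δ u) →
                ∀ w → length w ≡ N → ε w ≡ δ w
digits-unique {ε} {δ} N agree w |w|≡N = begin
  ε w             ≡⟨ cong ε (apply-inverseʳ ε w) ⟨
  ε (apply ε u)   ≡⟨ image-digit u (≤-reflexive (trans (length-apply (inverse ε) w) |w|≡N)) ⟩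
  δ (apply δ u)   ≡⟨ cong δ (agree u (≤-trans (≤-reflexive (trans (length-apply (inverse ε) w) |w|≡N)) (n≤1+n N))) ⟨
  δ (apply ε u)   ≡⟨ cong δ (apply-inverseʳ ε w) ⟩
  δ w             ∎
  where
  u = apply (inverse ε) w
  parity-eq : ∀ u → length u ≤ N → parity ε u ≡ parity δ u
  parity-eq u l = proj₁ (∷-injective (agree (false ∷ u) (s≤s l)))
  image-digit : ∀ u → length u ≤ N → ε (apply ε u) ≡ δ (apply δ u)
  image-digit []      _ = parity-eq [] z≤n
  image-digit (a ∷ u) l = xor-injectiveˡ (parity ε u)
    (trans (parity-eq (a ∷ u) l) (cong (_xor δ (apply δ (a ∷ u))) (sym (parity-eq u (≤-trans (n≤1+n _) l)))))

-- single N v : the digits of σ_N = ∏_{w ∈ L_N} σ_w^{v w};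
-- truncate N ε : the digits of σ_{N-1} ⋯ σ_0.
single : ℕ → Vect → Digits
single N v w = if does (length w ≟ℕ N) then v w else false

truncate : ℕ → Digits → Digits
truncate N ε w = if does (length w <? N) then ε w else false

single-≡ : ∀ {N} v w → length w ≡ N → single N v w ≡ v w
single-≡ {N} v w l rewrite dec-true (length w ≟ℕ N) l = refl

single-≢ : ∀ {N} v w → ¬ length w ≡ N → single N v w ≡ false
single-≢ {N} v w l rewrite dec-false (length w ≟ℕ N) l = refl

truncate-< : ∀ {N} ε w → length w < N → truncate N ε w ≡ ε w
truncate-< {N} ε w l rewrite dec-true (length w <? N) l = refl

truncate-≥ : ∀ {N} ε w → N ≤ length w → truncate N ε w ≡ false
truncate-≥ {N} ε w l rewrite dec-false (length w <? N) (≤⇒≯ l) = refl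

single-vanishesBelow : ∀ {N} v → VanishesBelow N (single N v)
single-vanishesBelow v w l = single-≢ v w (<⇒≢ l)

truncate-suc : ∀ N ε w → (single N ε ∙ truncate N ε) w ≡ truncate (suc N) ε w
truncate-suc N ε w with <-cmp (length w) N
... | tri< lt _ _ = begin
  (single N ε ∙ truncate N ε) w     ≡⟨ ∙-vanishingBelow (single-vanishesBelow {N} ε) (truncate N ε) w (<⇒≤ lt) ⟩
  single N ε w xor truncate N ε w   ≡⟨ cong₂ _xor_ (single-≢ ε w (<⇒≢ lt)) (truncate-< ε w lt) ⟩
  ε w                               ≡⟨ truncate-< ε w (≤-trans lt (n≤1+n N)) ⟨
  truncate (suc N) ε w              ∎
... | tri≈ _ eq _ = begin
  (single N ε ∙ truncate N ε) w     ≡⟨ ∙-vanishingBelow (single-vanishesBelow {N} ε) (truncate N ε) w (≤-reflexive eq) ⟩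
  single N ε w xor truncate N ε w   ≡⟨ cong₂ _xor_ (single-≡ ε w eq) (truncate-≥ ε w (≤-reflexive (sym eq))) ⟩
  ε w xor false                     ≡⟨ xor-identityʳ (ε w) ⟩
  ε w                               ≡⟨ truncate-< ε w (s≤s (≤-reflexive eq)) ⟨
  truncate (suc N) ε w              ∎
... | tri> _ ne gt = cong₂ _xor_ (single-≢ ε w ne)
  (trans (truncate-≥ ε _ (≤-trans (<⇒≤ gt) (≤-reflexive (sym (length-apply _ w))))) (sym (truncate-≥ ε w gt)))

single-cong : ∀ {N u v} → EqOn N u v → ∀ w → single N u w ≡ single N v w
single-cong {N} {u} {v} u≈v w with length w ≟ℕ N
... | yes l = trans (single-≡ u w l) (trans (u≈v w l) (sym (single-≡ v w l)))
... | no l  = trans (single-≢ u w l) (sym (single-≢ v w l))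

single-zero : ∀ {N v} → (∀ w → length w ≡ N → v w ≡ false) → ∀ w → single N v w ≡ false
single-zero {N} {v} v≈0 w with length w ≟ℕ N
... | yes l = trans (single-≡ v w l) (v≈0 w l)
... | no l  = single-≢ v w l

single-∙ : ∀ N u v w → (single N u ∙ single N v) w ≡ single N (λ w → u w xor v w) w
single-∙ N u v w with length w ≟ℕ N
... | yes l = trans (∙-vanishingBelow (single-vanishesBelow u) (single N v) w (≤-reflexive l))
                    (trans (cong₂ _xor_ (single-≡ u w l) (single-≡ v w l)) (sym (single-≡ u+v w l)))
  where u+v = λ w → u w xor v w
... | no l  = trans (cong₂ _xor_ (single-≢ u w l) (single-≢ v _ (λ e → l (trans (sym (length-apply _ w)) e))))
                    (sym (single-≢ u+v w l))
  where u+v = λ w → u w xor v w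

-- The action defined by the digital representation

flipIf : Bool → Word → Word
flipIf b = map (b xor_)

flipIf-flipIf : ∀ a b v → flipIf a (flipIf b v) ≡ flipIf (a xor b) v
flipIf-flipIf a b v = trans (sym (map-∘ v)) (map-cong (λ c → sym (xor-assoc a b c)) v)

splitAt-++ : (v s : Word) → splitAt (length v) (v ++ s) ≡ (v , s)
splitAt-++ []      s = refl
splitAt-++ (b ∷ v) s rewrite splitAt-++ v s = refl

splitAt-∸ : (w v s : Word) → length w ≡ length s → splitAt (length (v ++ s) ∸ length w) (v ++ s) ≡ (v , s)
splitAt-∸ w v s |w|≡|s| rewrite length-++ v {s} | |w|≡|s| | m+n∸n≡m (length v) (length s) = splitAt-++ v s

stripSuffix-++ : (w v s : Word) → length w ≡ length s →
  stripSuffix w (v ++ s) ≡ (if does (s ≟W w) then just v else nothing)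
stripSuffix-++ w v s |w|≡|s| with splitAt (length (v ++ s) ∸ length w) (v ++ s) in split
... | p with trans (sym split) (splitAt-∸ w v s |w|≡|s|)
...   | refl with s ≟W w
...     | yes _ = refl
...     | no _  = refl

sigma-++ : (w v s : Word) → length w ≡ length s → sigma w (v ++ s) ≡ flipIf (does (s ≟W w)) v ++ s
sigma-++ w v s |w|≡|s| rewrite stripSuffix-++ w v s |w|≡|s| with s ≟W w
... | yes refl = refl
... | no _     = cong (_++ s) (sym (map-id v))

sigmaProduct : Digits → List Word → Word → Word
sigmaProduct ε = foldr (λ w f → if ε w then sigma w ∘ f else f) id

digitIn : Digits → List Word → Word → Bool
digitIn ε Ws s = foldr (λ w b → (ε w ∧ does (s ≟W w)) xor b) false Ws

sigmaProduct-++ : ∀ ε {Ws} v s → All (λ w → length w ≡ length s) Ws →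
  sigmaProduct ε Ws (v ++ s) ≡ flipIf (digitIn ε Ws s) v ++ s
sigmaProduct-++ ε v s []                  = cong (_++ s) (sym (map-id v))
sigmaProduct-++ ε v s (_∷_ {w} {Ws} l ls) with ε w
... | false = sigmaProduct-++ ε v s ls
... | true  = begin
  sigma w (sigmaProduct ε Ws (v ++ s))                          ≡⟨ cong (sigma w) (sigmaProduct-++ ε v s ls) ⟩
  sigma w (flipIf (digitIn ε Ws s) v ++ s)                      ≡⟨ sigma-++ w _ s l ⟩
  flipIf (does (s ≟W w)) (flipIf (digitIn ε Ws s) v) ++ s       ≡⟨ cong (_++ s) (flipIf-flipIf (does (s ≟W w)) (digitIn ε Ws s) v) ⟩
  flipIf (does (s ≟W w) xor digitIn ε Ws s) v ++ s              ∎

children : Word → List Word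
children w = (false ∷ w) ∷ (true ∷ w) ∷ []

length-L : ∀ N → All (λ w → length w ≡ N) (L N)
length-L zero    = refl ∷ []
length-L (suc N) = concat⁺ (map⁺ (All.map (λ l → cong suc l ∷ cong suc l ∷ []) (length-L N)))

digitIn-children : ∀ φ b s Ws → digitIn φ (concatMap children Ws) (b ∷ s) ≡ digitIn (φ ∘ (b ∷_)) Ws s
digitIn-children φ b     s []       = refl
digitIn-children φ false s (w ∷ Ws) =
  cong₂ (λ x y → (φ (false ∷ w) ∧ does (s ≟W w)) xor (x xor y)) (∧-zeroʳ (φ (true ∷ w))) (digitIn-children φ false s Ws)
digitIn-children φ true  s (w ∷ Ws) =
  cong₂ (λ x y → x xor ((φ (true ∷ w) ∧ does (s ≟W w)) xor y)) (∧-zeroʳ (φ (false ∷ w))) (digitIn-children φ true s Ws)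

digitIn-L : ∀ N φ s → length s ≡ N → digitIn φ (L N) s ≡ φ s
digitIn-L zero    φ []      _ = trans (xor-identityʳ _) (∧-identityʳ (φ []))
digitIn-L (suc N) φ (b ∷ s) l = trans (digitIn-children φ b s (L N)) (digitIn-L N (φ ∘ (b ∷_)) s (suc-injective l))

level-++ : ∀ ε v s → level ε (length s) (v ++ s) ≡ flipIf (ε s) v ++ s
level-++ ε v s = trans (sigmaProduct-++ ε v s (length-L (length s)))
                       (cong (λ b → flipIf b v ++ s) (digitIn-L (length s) ε s refl))

parity-vanishingBelow : ∀ {ε} u → VanishesBelow (length u) ε → parity ε u ≡ ε u
parity-vanishingBelow     []      _   = refl
parity-vanishingBelow {ε} (a ∷ u) ε≈0 = cong₂ _xor_ (parity-trivial u ε≈0) (cong ε (apply-trivial ε≈0 ≤-refl))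

parity-single-++ : ∀ ε v s → parity (single (length s) ε) (v ++ s) ≡ ε s
parity-single-++ ε []      s = trans (parity-vanishingBelow s (single-vanishesBelow ε)) (single-≡ ε s refl)
parity-single-++ ε (b ∷ v) s = trans (cong₂ _xor_ (parity-single-++ ε v s) (single-≢ ε _ above)) (xor-identityʳ (ε s))
  where
  above : ¬ length (apply (single (length s) ε) (b ∷ v ++ s)) ≡ length s
  above e = m≢1+n+m (length s) (sym (trans (sym (cong suc (length-++ v))) (trans (sym (length-apply _ (b ∷ v ++ s))) e)))

apply-single-++ : ∀ ε v s → apply (single (length s) ε) (v ++ s) ≡ flipIf (ε s) v ++ s
apply-single-++ ε []      s = apply-trivial (single-vanishesBelow ε) ≤-refl
apply-single-++ ε (b ∷ v) s =
  cong₂ _∷_ (trans (cong (b xor_) (parity-single-++ ε v s)) (xor-comm b (ε s))) (apply-single-++ ε v s)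

level≗apply-single : ∀ ε N u → N ≤ length u → level ε N u ≡ apply (single N ε) u
level≗apply-single ε N u N≤|u| = begin
  level ε N u                     ≡⟨ cong (level ε N) (take++drop≡id k u) ⟨
  level ε N (v ++ s)              ≡⟨ cong (λ n → level ε n (v ++ s)) |s|≡N ⟨
  level ε (length s) (v ++ s)     ≡⟨ level-++ ε v s ⟩
  flipIf (ε s) v ++ s             ≡⟨ apply-single-++ ε v s ⟨
  apply (single (length s) ε) (v ++ s) ≡⟨ cong (λ n → apply (single n ε) (v ++ s)) |s|≡N ⟩
  apply (single N ε) (v ++ s)     ≡⟨ cong (apply (single N ε)) (take++drop≡id k u) ⟩
  apply (single N ε) u            ∎
  where
  k = length u ∸ N
  v = take k u
  s = drop k u
  |s|≡N : length s ≡ N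
  |s|≡N = trans (length-drop k u) (m∸[m∸n]≡n N≤|u|)

levelsBelow≗apply-truncate : ∀ ε n u → n ≤ length u → levelsBelow ε n u ≡ apply (truncate n ε) u
levelsBelow≗apply-truncate ε zero    u _ = sym (trans (apply-cong u (λ w _ → truncate-≥ ε w z≤n)) (apply-zeros u))
levelsBelow≗apply-truncate ε (suc n) u n<|u| = begin
  level ε n (levelsBelow ε n u)               ≡⟨ cong (level ε n) (levelsBelow≗apply-truncate ε n u n≤|u|) ⟩
  level ε n (apply (truncate n ε) u)          ≡⟨ level≗apply-single ε n _ (≤-trans n≤|u| (≤-reflexive (sym (length-apply _ u)))) ⟩
  apply (single n ε) (apply (truncate n ε) u) ≡⟨ apply-∙ (single n ε) (truncate n ε) u ⟨
  apply (single n ε ∙ truncate n ε) u         ≡⟨ apply-cong u (λ w _ → truncate-suc n ε w) ⟩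
  apply (truncate (suc n) ε) u                ∎
  where
  n≤|u| = ≤-trans (n≤1+n n) n<|u|

act≗apply : ∀ ε → act ε ≗ apply ε
act≗apply ε u = trans (levelsBelow≗apply-truncate ε (length u) u ≤-refl) (apply-cong u (λ w l → truncate-< ε w l))

HasDigits : Map → Set
HasDigits f = Σ[ ε ∈ Digits ] f ≗ apply ε

InΩ⇒HasDigits : ∀ {f} → InΩ f → HasDigits f
InΩ⇒HasDigits (ε , f≗act) = ε , λ u → trans (f≗act u) (act≗apply ε u)

HasDigits⇒InΩ : ∀ {f} → HasDigits f → InΩ f
HasDigits⇒InΩ (ε , f≗ε) = ε , λ u → trans (f≗ε u) (sym (act≗apply ε u))

apply-InΩ : ∀ ε → InΩ (apply ε)
apply-InΩ ε = HasDigits⇒InΩ (ε , λ _ → refl)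

HasDigits-length : ∀ {f} → HasDigits f → ∀ u → length (f u) ≡ length u
HasDigits-length (ε , f≗ε) u = trans (cong length (f≗ε u)) (length-apply ε u)

≗apply-isInverse : ∀ {f ε} → f ≗ apply ε → IsInverse f (apply (inverse ε))
≗apply-isInverse {f} {ε} f≗ε =
  (λ u → trans (f≗ε _) (apply-inverseʳ ε u)) ,
  (λ u → trans (cong (apply (inverse ε)) (f≗ε u)) (apply-inverseˡ ε u))

apply-isInverse : ∀ ε → IsInverse (apply ε) (apply (inverse ε))
apply-isInverse ε = ≗apply-isInverse (λ _ → refl)

inverse-≗ : ∀ {f g ε} → f ≗ apply ε → IsInverse f g → g ≗ apply (inverse ε)
inverse-≗ {f} {g} {ε} f≗ε (f∘g≗id , _) u = begin
  g u                               ≡⟨ apply-inverseˡ ε (g u) ⟨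
  apply (inverse ε) (apply ε (g u)) ≡⟨ cong (apply (inverse ε)) (f≗ε (g u)) ⟨
  apply (inverse ε) (f (g u))       ≡⟨ cong (apply (inverse ε)) (f∘g≗id u) ⟩
  apply (inverse ε) u               ∎

∘-≗ : ∀ {f g ε δ} → f ≗ apply ε → g ≗ apply δ → f ∘ g ≗ apply (ε ∙ δ)
∘-≗ {f} {g} {ε} {δ} f≗ε g≗δ u = trans (f≗ε (g u)) (trans (cong (apply ε) (g≗δ u)) (sym (apply-∙ ε δ u)))

commutatorᵈ : Digits → Digits → Digits
commutatorᵈ γ η = inverse γ ∙ (inverse η ∙ (γ ∙ η))

commutator-≗ : ∀ {g g' h h' γ η} → g ≗ apply γ → IsInverse g g' → h ≗ apply η → IsInverse h h' →
               g' ∘ h' ∘ g ∘ h ≗ apply (commutatorᵈ γ η)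
commutator-≗ g≗γ g⁻¹ h≗η h⁻¹ = ∘-≗ (inverse-≗ g≗γ g⁻¹) (∘-≗ (inverse-≗ h≗η h⁻¹) (∘-≗ g≗γ h≗η))

commutatorᵈ-formula : ∀ γ η w → let w₁ = apply γ w; w₂ = apply η w₁ in
  commutatorᵈ γ η w ≡ (γ (apply η w₁) xor γ w₁) xor (η (apply (inverse γ) w₂) xor η w₂)
commutatorᵈ-formula γ η w = begin
  γ w₁ xor inverse η (apply (inverse (inverse γ)) w) xor (γ ∙ η) (apply (inverse (inverse η)) (apply (inverse (inverse γ)) w))
    ≡⟨ cong (λ x → γ w₁ xor inverse η x xor (γ ∙ η) (apply (inverse (inverse η)) x)) (apply-inverse² γ w) ⟩
  γ w₁ xor η w₂ xor (γ ∙ η) (apply (inverse (inverse η)) w₁)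
    ≡⟨ cong (λ x → γ w₁ xor η w₂ xor (γ ∙ η) x) (apply-inverse² η w₁) ⟩
  γ w₁ xor η w₂ xor γ w₂ xor η (apply (inverse γ) w₂)
    ≡⟨ shuffle (γ w₁) (η w₂) (γ w₂) (η (apply (inverse γ) w₂)) ⟩
  (γ w₂ xor γ w₁) xor (η (apply (inverse γ) w₂) xor η w₂) ∎
  where
  w₁ = apply γ w
  w₂ = apply η w₁
  apply-inverse² : ∀ ε u → apply (inverse (inverse ε)) u ≡ apply ε u
  apply-inverse² ε u = apply-cong u (λ v _ → inverse-involutive ε v)
  shuffle : ∀ a b c d → a xor b xor c xor d ≡ (c xor a) xor (d xor b)
  shuffle = solve-∀ xor-ring

GenComm⇒HasDigits : ∀ {P h} → (∀ {f} → P f → HasDigits f) → GenComm P h → HasDigits h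
GenComm⇒HasDigits P⇒D (comm g g' h h' g∈Ω g⁻¹ h∈P h⁻¹) with InΩ⇒HasDigits g∈Ω | P⇒D h∈P
... | γ , g≗γ | η , h≗η = commutatorᵈ γ η , commutator-≗ g≗γ g⁻¹ h≗η h⁻¹
GenComm⇒HasDigits P⇒D one = zeros , λ u → sym (apply-zeros u)
GenComm⇒HasDigits P⇒D (mul a b) with GenComm⇒HasDigits P⇒D a | GenComm⇒HasDigits P⇒D b
... | ε , f≗ε | δ , g≗δ = ε ∙ δ , ∘-≗ f≗ε g≗δ
GenComm⇒HasDigits P⇒D (inv a f⁻¹) with GenComm⇒HasDigits P⇒D a
... | ε , f≗ε = inverse ε , inverse-≗ f≗ε f⁻¹
GenComm⇒HasDigits P⇒D (ext a f≗g) with GenComm⇒HasDigits P⇒D a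
... | ε , f≗ε = ε , λ u → trans (sym (f≗g u)) (f≗ε u)

LCS⇒HasDigits : ∀ j {f} → LCS j f → HasDigits f
LCS⇒HasDigits zero    f∈Ω       = InΩ⇒HasDigits f∈Ω
LCS⇒HasDigits (suc j) (f∈Ω , _) = InΩ⇒HasDigits f∈Ω

LCS-≗ : ∀ j {f g} → LCS j f → f ≗ g → LCS j g
LCS-≗ zero    f∈Ω          f≗g = HasDigits⇒InΩ (_ , λ u → trans (sym (f≗g u)) (proj₂ (InΩ⇒HasDigits f∈Ω) u))
LCS-≗ (suc j) (f∈Ω , approx) f≗g =
  LCS-≗ zero f∈Ω f≗g ,
  λ N → let h , h∈G , h≈f = approx N in h , h∈G , λ u l → trans (h≈f u l) (f≗g u)

AgreeUpTo-inverse : ∀ {N h h' f f'} → IsInverse h h' → IsInverse f f' → (∀ u → length (f' u) ≡ length u) →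
                    AgreeUpTo N h f → AgreeUpTo N h' f'
AgreeUpTo-inverse {N} {h} {h'} {f} {f'} (_ , h'∘h≗id) (f∘f'≗id , _) |f'| h≈f u |u|≤N = begin
  h' u          ≡⟨ cong h' (f∘f'≗id u) ⟨
  h' (f (f' u)) ≡⟨ cong h' (h≈f (f' u) (subst (_≤ N) (sym (|f'| u)) |u|≤N)) ⟨
  h' (h (f' u)) ≡⟨ h'∘h≗id (f' u) ⟩
  f' u          ∎

LCS-inverse : ∀ j {f g} → LCS j f → IsInverse f g → LCS j g
LCS-inverse zero    f∈Ω          f⁻¹ = HasDigits⇒InΩ (_ , inverse-≗ (proj₂ (InΩ⇒HasDigits f∈Ω)) f⁻¹)
LCS-inverse (suc j) {f} {g} (f∈Ω , approx) f⁻¹ = g∈Ω , λ N → inverse-approximant (approx N)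
  where
  g∈Ω : InΩ g
  g∈Ω = LCS-inverse zero f∈Ω f⁻¹
  inverse-approximant : ∀ {N} → Σ[ h ∈ Map ] GenComm (LCS j) h × AgreeUpTo N h f →
                        Σ[ h ∈ Map ] GenComm (LCS j) h × AgreeUpTo N h g
  inverse-approximant (h , h∈G , h≈f) with GenComm⇒HasDigits (LCS⇒HasDigits j) h∈G
  ... | η , h≗η = apply (inverse η) , inv h∈G (≗apply-isInverse h≗η) ,
    AgreeUpTo-inverse (≗apply-isInverse h≗η) f⁻¹ (HasDigits-length (InΩ⇒HasDigits g∈Ω)) h≈f

-- The augmentation filtration of F₂^{L_N}

module Augmentation (N : ℕ) where

  Prod-weaken₁ : ∀ k {v} → Prod N (suc k) v → Prod N k v
  Prod-weaken₁ zero    _                         = tt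
  Prod-weaken₁ (suc k) (δ , g' , g'⁻¹ , u , u∈I , v≈) = δ , g' , g'⁻¹ , u , Prod-weaken₁ k u∈I , v≈

  AugPow-cast : ∀ {k k' v} → k ≡ k' → AugPow N k v → AugPow N k' v
  AugPow-cast refl a = a

  AugPow-weaken₁ : ∀ {k v} → AugPow N (suc k) v → AugPow N k v
  AugPow-weaken₁ (zer v≈0)  = zer v≈0
  AugPow-weaken₁ (gen p)    = gen (Prod-weaken₁ _ p)
  AugPow-weaken₁ (add a b)  = add (AugPow-weaken₁ a) (AugPow-weaken₁ b)
  AugPow-weaken₁ (ext a e)  = ext (AugPow-weaken₁ a) e

  AugPow-weaken : ∀ m {k v} → AugPow N (m + k) v → AugPow N k v
  AugPow-weaken zero    a = a
  AugPow-weaken (suc m) a = AugPow-weaken m (AugPow-weaken₁ a)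

  -- Multiplication by g − 1 for g = act (inverse ε), the inverse of apply ε.
  AugPow-step : ∀ ε {k v} → AugPow N k v → AugPow N (suc k) (λ w → v (apply ε w) xor v w)
  AugPow-step ε (zer v≈0)  = zer λ w l → cong₂ _xor_ (v≈0 _ (trans (length-apply ε w) l)) (v≈0 w l)
  AugPow-step ε {v = v} (gen p) =
    gen (inverse ε , apply ε , (λ w _ → trans (act≗apply _ _) (apply-inverseˡ ε w)) , v , p , λ _ _ → refl)
  AugPow-step ε (add {u} {v} a b) = ext (add (AugPow-step ε a) (AugPow-step ε b))
    λ w _ → xor-interchange (u (apply ε w)) (u w) (v (apply ε w)) (v w)
  AugPow-step ε (ext {u} {v} a e) = ext (AugPow-step ε a)
    λ w l → cong₂ _xor_ (e _ (trans (length-apply ε w) l)) (e w l)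

  -- (f⁻¹ − 1)·I^k F₂^{L_N} ⊆ I^{j+k} F₂^{L_N} for every k, as (g·v)(w) = v(g⁻¹ w).
  Raises : ℕ → Map → Set
  Raises j f = ∀ {k v} → AugPow N k v → AugPow N (j + k) (λ w → v (f w) xor v w)

  Raises-≗ : ∀ {j f g} → (∀ w → length w ≡ N → f w ≡ g w) → Raises j f → Raises j g
  Raises-≗ f≈g f↑ {v = v} a = ext (f↑ a) λ w l → cong (λ x → v x xor v w) (f≈g w l)

  apply-raises : ∀ ε → Raises 1 (apply ε)
  apply-raises ε = AugPow-step ε

  AugPow-∘ : ∀ {j f k v} → Raises j f → AugPow N k v → AugPow N k (v ∘ f)
  AugPow-∘ {j} {f} {v = v} f↑ a = ext (add (AugPow-weaken j (f↑ a)) a) λ w _ → xor-cancelʳ (v (f w)) (v w)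

  AugPow-∘apply : ∀ ε {k v} → AugPow N k v → AugPow N k (v ∘ apply ε)
  AugPow-∘apply ε = AugPow-∘ (apply-raises ε)

  Raises-id : ∀ {j} → Raises j id
  Raises-id {v = v} _ = zer λ w _ → xor-same (v w)

  Raises-∘ : ∀ {j f g} → Raises j f → Raises j g → Raises j (f ∘ g)
  Raises-∘ {f = f} {g} f↑ g↑ {v = v} a =
    ext (add (AugPow-∘ g↑ (f↑ a)) (g↑ a)) λ w _ → telescope (v (f (g w))) (v (g w)) (v w)
    where
    telescope : ∀ x y z → (x xor y) xor (y xor z) ≡ x xor z
    telescope = solve-∀ xor-ring

  Raises-inverse : ∀ {j f g} → HasDigits g → IsInverse f g → Raises j f → Raises j g
  Raises-inverse {f = f} {g} (η , g≗η) (_ , g∘f≗id) f↑ {v = v} a =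
    ext (f↑ (AugPow-∘ (Raises-≗ (λ w _ → sym (g≗η w)) (apply-raises η)) a))
        λ w _ → trans (cong (_xor v (g w)) (cong v (g∘f≗id w))) (xor-comm (v w) (v (g w)))

  -- With d = v ∘ x' ∘ y', the vector v ∘ [x , y] + v equals d ∘ x ∘ y + d ∘ y ∘ x,
  -- which is (E ∘ y + E) + (F ∘ x + F) for E = d ∘ x + d and F = d ∘ y + d.
  Raises-commutator : ∀ {a b x x' y y'} → Raises a x → Raises b y → Raises a x' → Raises b y' →
    (∀ w → x' (x w) ≡ w) → (∀ w → y' (y w) ≡ w) → Raises (a + b) (x' ∘ y' ∘ x ∘ y)
  Raises-commutator {a} {b} {x} {x'} {y} {y'} x↑ y↑ x'↑ y'↑ x'∘x≗id y'∘y≗id {k} {v} v∈I =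
    ext (add E∘y+E F∘x+F) λ w _ →
      trans (regroup (d (x (y w))) (d (y w)) (d (x w)) (d w) (d (y (x w))))
            (cong (d (x (y w)) xor_) (d∘y∘x≗v w))
    where
    d : Vect
    d = v ∘ x' ∘ y'
    d∈I : AugPow N k d
    d∈I = AugPow-∘ y'↑ (AugPow-∘ x'↑ v∈I)
    E F : Vect
    E w = d (x w) xor d w
    F w = d (y w) xor d w
    E∘y+E : AugPow N ((a + b) + k) (λ w → E (y w) xor E w)
    E∘y+E = AugPow-cast (trans (sym (+-assoc b a k)) (cong (_+ k) (+-comm b a))) (y↑ (x↑ d∈I))
    F∘x+F : AugPow N ((a + b) + k) (λ w → F (x w) xor F w)
    F∘x+F = AugPow-cast (sym (+-assoc a b k)) (x↑ (y↑ d∈I))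
    d∘y∘x≗v : ∀ w → d (y (x w)) ≡ v w
    d∘y∘x≗v w = cong v (trans (cong x' (y'∘y≗id (x w))) (x'∘x≗id w))
    regroup : ∀ p q r s t → ((p xor q) xor (r xor s)) xor ((t xor r) xor (q xor s)) ≡ p xor t
    regroup = solve-∀ xor-ring

open Augmentation

mutual
  LCS-raises : ∀ j N {f} → LCS j f → Raises N (suc j) f
  LCS-raises zero    N f∈Ω with InΩ⇒HasDigits f∈Ω
  ... | ε , f≗ε = Raises-≗ N (λ w _ → sym (f≗ε w)) (apply-raises N ε)
  LCS-raises (suc j) N (_ , approx) with approx N
  ... | h , h∈G , h≈f = Raises-≗ N (λ w l → h≈f w (≤-reflexive l)) (GenComm-raises j N h∈G)

  GenComm-raises : ∀ j N {h} → GenComm (LCS j) h → Raises N (suc (suc j)) h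
  GenComm-raises j N (comm g g' h h' g∈Ω g⁻¹ h∈L h⁻¹) =
    Raises-commutator N (LCS-raises 0 N g∈Ω) (LCS-raises j N h∈L)
      (LCS-raises 0 N (LCS-inverse 0 g∈Ω g⁻¹)) (LCS-raises j N (LCS-inverse j h∈L h⁻¹))
      (proj₂ g⁻¹) (proj₂ h⁻¹)
  GenComm-raises j N one         = Raises-id N
  GenComm-raises j N (mul a b)   = Raises-∘ N (GenComm-raises j N a) (GenComm-raises j N b)
  GenComm-raises j N (inv a f⁻¹) =
    Raises-inverse N (GenComm⇒HasDigits (LCS⇒HasDigits j) (inv a f⁻¹)) f⁻¹ (GenComm-raises j N a)
  GenComm-raises j N (ext a f≗g) = Raises-≗ N (λ w _ → f≗g w) (GenComm-raises j N a)

-- Digits of elements of Ω_∞^{(i)}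

mutual
  LCS⇒AugPow : ∀ j {f ε} → LCS j f → f ≗ apply ε → ∀ N → AugPow N j ε
  LCS⇒AugPow zero    _            _   N = gen tt
  LCS⇒AugPow (suc j) (_ , approx) f≗ε N with approx (suc N)
  ... | h , h∈G , h≈f with GenComm-digits j N h∈G
  ...   | η , h≗η , η∈I = ext η∈I λ w l → digits-unique N (λ u l' → trans (sym (h≗η u)) (trans (h≈f u l') (f≗ε u))) w l

  GenComm-digits : ∀ j N {h} → GenComm (LCS j) h → Σ[ η ∈ Digits ] h ≗ apply η × AugPow N (suc j) η
  GenComm-digits j N (comm g g' h h' g∈Ω g⁻¹ h∈L h⁻¹) with InΩ⇒HasDigits g∈Ω | LCS⇒HasDigits j h∈L
  ... | γ , g≗γ | η , h≗η =
    commutatorᵈ γ η , commutator-≗ g≗γ g⁻¹ h≗η h⁻¹ ,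
    ext (add (AugPow-∘apply N γ V₁∈I) (AugPow-∘apply N γ (AugPow-∘apply N η V₂∈I)))
        λ w _ → sym (commutatorᵈ-formula γ η w)
    where
    V₁∈I : AugPow N (suc j) (λ w → γ (apply η w) xor γ w)
    V₁∈I = AugPow-cast N (+-identityʳ (suc j)) (Raises-≗ N (λ w _ → h≗η w) (LCS-raises j N h∈L) (gen {v = γ} tt))
    V₂∈I : AugPow N (suc j) (λ w → η (apply (inverse γ) w) xor η w)
    V₂∈I = AugPow-step N (inverse γ) (LCS⇒AugPow j h∈L h≗η N)
  GenComm-digits j N one = zeros , (λ u → sym (apply-zeros u)) , zer λ _ _ → refl
  GenComm-digits j N (mul a b) with GenComm-digits j N a | GenComm-digits j N b
  ... | ε , f≗ε , ε∈I | δ , g≗δ , δ∈I = ε ∙ δ , ∘-≗ f≗ε g≗δ , add ε∈I (AugPow-∘apply N (inverse ε) δ∈I)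
  GenComm-digits j N (inv a f⁻¹) with GenComm-digits j N a
  ... | ε , f≗ε , ε∈I = inverse ε , inverse-≗ f≗ε f⁻¹ , AugPow-∘apply N ε ε∈I
  GenComm-digits j N (ext a f≗g) with GenComm-digits j N a
  ... | ε , f≗ε , ε∈I = ε , (λ u → trans (sym (f≗g u)) (f≗ε u)) , ε∈I

-- Elements whose digits lie in the augmentation powers

commutatorᵈ-single : ∀ {N γ} u → (∀ w → N ≤ length w → γ w ≡ false) →
                     ∀ w → commutatorᵈ γ (single N u) w ≡ single N (λ w → u (apply γ w) xor u w) w
commutatorᵈ-single {N} {γ} u γ≈0 w = begin
  commutatorᵈ γ S w                                                   ≡⟨ commutatorᵈ-formula γ S w ⟩
  (γ (apply S w₁) xor γ w₁) xor (S (apply (inverse γ) w₂) xor S w₂)   ≡⟨ cong (_xor (S (apply (inverse γ) w₂) xor S w₂)) (γ-part w₁) ⟩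
  S (apply (inverse γ) w₂) xor S w₂                                   ≡⟨ S-part ⟩
  single N v w                                                        ∎
  where
  S  = single N u
  w₁ = apply γ w
  w₂ = apply S w₁
  v : Vect
  v w = u (apply γ w) xor u w
  γ-part : ∀ x → γ (apply S x) xor γ x ≡ false
  γ-part x with ≤-total (length x) N
  ... | inj₁ x≤N = trans (cong (λ y → γ y xor γ x) (apply-trivial (single-vanishesBelow u) x≤N)) (xor-same (γ x))
  ... | inj₂ N≤x = cong₂ _xor_ (γ≈0 _ (≤-trans N≤x (≤-reflexive (sym (length-apply S x))))) (γ≈0 x N≤x)
  |w₂|≡|w| : length w₂ ≡ length w
  |w₂|≡|w| = trans (length-apply S w₁) (length-apply γ w)
  S-part : S (apply (inverse γ) w₂) xor S w₂ ≡ single N v w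
  S-part with length w ≟ℕ N
  ... | no l  = trans (cong₂ _xor_
                        (single-≢ u (apply (inverse γ) w₂) (λ e → l (trans (sym (trans (length-apply _ w₂) |w₂|≡|w|)) e)))
                        (single-≢ u w₂ (λ e → l (trans (sym |w₂|≡|w|) e))))
                      (sym (single-≢ v w l))
  ... | yes l = begin
    S (apply (inverse γ) w₂) xor S w₂   ≡⟨ cong (λ y → S (apply (inverse γ) y) xor S y) w₂≡w₁ ⟩
    S (apply (inverse γ) w₁) xor S w₁   ≡⟨ cong (λ y → S y xor S w₁) (apply-inverseˡ γ w) ⟩
    S w xor S w₁                        ≡⟨ cong₂ _xor_ (single-≡ u w l) (single-≡ u w₁ (trans (length-apply γ w) l)) ⟩
    u w xor u w₁                        ≡⟨ xor-comm (u w) (u w₁) ⟩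
    u w₁ xor u w                        ≡⟨ single-≡ v w l ⟨
    single N v w                        ∎
    where
    w₂≡w₁ : w₂ ≡ w₁
    w₂≡w₁ = apply-trivial (single-vanishesBelow u) (≤-reflexive (trans (length-apply γ w) l))

AugPow-single-genComm : ∀ j N {v} → (∀ {u} → Prod N j u → LCS j (apply (single N u))) →
                        AugPow N (suc j) v → GenComm (LCS j) (apply (single N v))
AugPow-single-genComm j N prod⇒LCS (zer v≈0) =
  ext one λ u → sym (trans (apply-cong u (λ w _ → single-zero v≈0 w)) (apply-zeros u))
AugPow-single-genComm j N {v} prod⇒LCS (gen (δ , g' , act∘g'≈id , u , u∈I , v≈)) =
  ext (comm (apply γ) (apply (inverse γ)) (apply S) (apply (inverse S))
            (apply-InΩ γ) (apply-isInverse γ) (prod⇒LCS u∈I) (apply-isInverse S))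
      λ x → trans (commutator-≗ (λ _ → refl) (apply-isInverse γ) (λ _ → refl) (apply-isInverse S) x)
                  (apply-cong x λ w _ → trans (commutatorᵈ-single u (λ w → truncate-≥ (inverse δ) w) w) (single-cong v≈' w))
  where
  γ = truncate N (inverse δ)
  S = single N u
  g'≈γ : ∀ w → length w ≡ N → g' w ≡ apply γ w
  g'≈γ w l = begin
    g' w                                   ≡⟨ apply-inverseˡ δ (g' w) ⟨
    apply (inverse δ) (apply δ (g' w))     ≡⟨ cong (apply (inverse δ)) (trans (sym (act≗apply δ (g' w))) (act∘g'≈id w l)) ⟩
    apply (inverse δ) w                    ≡⟨ apply-cong w (λ x lx → truncate-< (inverse δ) x (<-≤-trans lx (≤-reflexive l))) ⟨
    apply γ w                              ∎
  v≈' : EqOn N (λ w → u (apply γ w) xor u w) v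
  v≈' w l = trans (cong (λ y → u y xor u w) (sym (g'≈γ w l))) (sym (v≈ w l))
AugPow-single-genComm j N prod⇒LCS (add {u} {v} a b) =
  ext (mul (AugPow-single-genComm j N prod⇒LCS a) (AugPow-single-genComm j N prod⇒LCS b))
      λ x → trans (sym (apply-∙ (single N u) (single N v) x)) (apply-cong x (λ w _ → single-∙ N u v w))
AugPow-single-genComm j N prod⇒LCS (ext a u≈v) =
  ext (AugPow-single-genComm j N prod⇒LCS a) λ x → apply-cong x (λ w _ → single-cong u≈v w)

mutual
  AugPow⇒LCS : ∀ i ε → (∀ N → AugPow N i ε) → LCS i (apply ε)
  AugPow⇒LCS zero    ε _   = apply-InΩ ε
  AugPow⇒LCS (suc j) ε ε∈I = apply-InΩ ε , λ N → apply (truncate N ε) , truncation∈G N , truncation≈ N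
    where
    truncation∈G : ∀ N → GenComm (LCS j) (apply (truncate N ε))
    truncation∈G zero    = ext one λ u → sym (trans (apply-cong u (λ w _ → truncate-≥ ε w z≤n)) (apply-zeros u))
    truncation∈G (suc N) =
      ext (mul (AugPow-single-genComm j N (Prod⇒LCS j N) (ε∈I N)) (truncation∈G N))
          λ u → trans (sym (apply-∙ (single N ε) (truncate N ε) u)) (apply-cong u (λ w _ → truncate-suc N ε w))
    truncation≈ : ∀ N → AgreeUpTo N (apply (truncate N ε)) (apply ε)
    truncation≈ N u |u|≤N = apply-cong u (λ w l → truncate-< ε w (<-≤-trans l |u|≤N))

  Prod⇒LCS : ∀ j N {u} → Prod N j u → LCS j (apply (single N u))
  Prod⇒LCS j N {u} u∈I = AugPow⇒LCS j (single N u) levels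
    where
    levels : ∀ N' → AugPow N' j (single N u)
    levels N' with N' ≟ℕ N
    ... | yes refl = ext (gen u∈I) λ w l → sym (single-≡ u w l)
    ... | no N'≢N  = zer λ w l → single-≢ u w (λ e → N'≢N (trans (sym l) e))

proposition6p1 : (i : ℕ) → 1 ≤ i → (ε : Digits) →
    LCS i (act ε) ⇔ (∀ N → AugPow N i ε)
proposition6p1 i _ ε = mk⇔
  (λ σ∈LCS → LCS⇒AugPow i σ∈LCS (act≗apply ε))
  (λ σ∈I → LCS-≗ i (AugPow⇒LCS i ε σ∈I) (λ u → sym (act≗apply ε u)))
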